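{- If $L$ is a finite distributive lattice, then $D(L)=1$ if and only if $D(Q_L)=1$.
   Context: A point of a lattice is join-irreducible if in the Hasse diagram it has exactly one downward edge; $Q_L$ is the subposet induced by the join-irreducible points of $L$. A coloring of a poset is distinguishing if the only color-preserving automorphism is the identity; $D(P)$ is the least number of colors in a distinguishing coloring of $P$. -}

module Defs where

open import Level using (Level; _⊔_)
open import Data.Nat using (ℕ) renaming (_<_ to _<ℕ_; _≤_ to _≤ℕ_)
open import Data.Fin using (Fin)
open import Data.Product using (Σ; ∃; _×_; proj₁)
open import Data.Sum using (_⊎_)
open import Relation.Nullary using (¬_)
open import Relation.Binary.Bundles using (Poset)
open import Relation.Binary.PropositionalEquality using (_≡_)
import Relation.Binary.PropositionalEquality as ≡
open import Relation.Binary.Lattice.Bundles using (DistributiveLattice)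
open import Function.Bundles using (Inverse)
import Relation.Binary.Construct.On as On

private variable c ℓ₁ ℓ₂ : Level

record Automorphism (P : Poset c ℓ₁ ℓ₂) : Set (c ⊔ ℓ₁ ⊔ ℓ₂) where
  open Poset P
  field
    fun        : Carrier → Carrier
    cong       : ∀ {x y} → x ≈ y → fun x ≈ fun y
    injective  : ∀ {x y} → fun x ≈ fun y → x ≈ y
    surjective : ∀ y → ∃ λ x → fun x ≈ y
    preserves  : ∀ {x y} → x ≤ y → fun x ≤ fun y
    reflects   : ∀ {x y} → fun x ≤ fun y → x ≤ y

record Coloring (P : Poset c ℓ₁ ℓ₂) (k : ℕ) : Set (c ⊔ ℓ₁) where
  open Poset P
  field
    color      : Carrier → Fin k
    color-cong : ∀ {x y} → x ≈ y → color x ≡ color y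

IsDistinguishing : (P : Poset c ℓ₁ ℓ₂) {k : ℕ} → Coloring P k → Set (c ⊔ ℓ₁ ⊔ ℓ₂)
IsDistinguishing P χ =
  (σ : Automorphism P) →
  (∀ x → color (Automorphism.fun σ x) ≡ color x) →
  ∀ x → Automorphism.fun σ x ≈ x
  where open Poset P
        open Coloring χ

HasDistinguishingColoring : (P : Poset c ℓ₁ ℓ₂) → ℕ → Set (c ⊔ ℓ₁ ⊔ ℓ₂)
HasDistinguishingColoring P k = Σ (Coloring P k) (IsDistinguishing P)

DistNumberIs : (P : Poset c ℓ₁ ℓ₂) → ℕ → Set (c ⊔ ℓ₁ ⊔ ℓ₂)
DistNumberIs P k =
  1 ≤ℕ k × HasDistinguishingColoring P k ×
  (∀ m → 1 ≤ℕ m → m <ℕ k → ¬ HasDistinguishingColoring P m)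

module _ (L : DistributiveLattice c ℓ₁ ℓ₂) where
  open DistributiveLattice L

  IsFinite : Set (c ⊔ ℓ₁)
  IsFinite = ∃ λ n → Inverse setoid (≡.setoid (Fin n))

  _⋖_ : Carrier → Carrier → Set (c ⊔ ℓ₁ ⊔ ℓ₂)
  x ⋖ y = (x ≤ y × ¬ (x ≈ y)) ×
          (∀ z → x ≤ z → z ≤ y → (z ≈ x) ⊎ (z ≈ y))

  -- y is join-irreducible: exactly one downward edge in the Hasse diagram.
  JoinIrreducible : Carrier → Set (c ⊔ ℓ₁ ⊔ ℓ₂)
  JoinIrreducible y = ∃ λ x → x ⋖ y × (∀ z → z ⋖ y → z ≈ x)

  Q : Poset (c ⊔ ℓ₁ ⊔ ℓ₂) ℓ₁ ℓ₂
  Q = On.poset poset (proj₁ {B = JoinIrreducible})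

module Submission where

-- A poset P has D(P) = 1 exactly when it is rigid, i.e. its only
-- automorphism is the identity.  So the theorem says: a finite
-- distributive lattice L is rigid iff its poset Q_L of join-irreducibles
-- is rigid.  Both directions rest on Birkhoff's picture of L as being
-- determined by Q_L:
--   * rigid Q_L ⇒ rigid L: an automorphism of L maps covers to covers,
--     hence restricts to Q_L; if it fixes Q_L pointwise it fixes L,
--     because join-irreducibles are join-dense (x ≤ y as soon as every
--     join-irreducible below x is below y).
--   * rigid L ⇒ rigid Q_L: an automorphism τ of Q_L extends to L by
--     x ↦ ⋁ { τ j | j ∈ Q_L, j ≤ x }; join-primeness of join-irreducibles
--     (this is where distributivity enters) makes it an automorphism.

open import Defs hiding (_⋖_; JoinIrreducible)
import Defs
open import Level using (Level; _⊔_)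
import Data.Nat as Nat
import Data.Nat.Properties as ℕ
open import Data.Fin using (Fin; zero; suc)
import Data.Fin.Properties as Fin
open import Data.Fin.Induction using (po-wellFounded)
open import Data.Product using (∃; _×_; _,_; proj₁; proj₂)
open import Data.Sum using (_⊎_; inj₁; inj₂)
import Data.Sum as Sum
open import Data.Empty using (⊥-elim)
open import Data.Unit using (⊤; tt)
open import Function.Base using (_on_; flip; _∘_)
open import Function.Bundles using (Inverse; _⇔_; mk⇔)
import Function.Properties.Equivalence as ⇔
open import Induction.WellFounded using (WellFounded; Acc; acc; module Subrelation)
open import Relation.Nullary using (¬_; Dec; yes; no)
open import Relation.Nullary.Decidable using (_×-dec_; _⊎-dec_; _→-dec_; ¬?; map′; decidable-stable)
open import Relation.Unary using (Pred) renaming (Decidable to Decidable₁)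
open import Relation.Binary.Definitions using (Decidable; _Respects_)
open import Relation.Binary.Bundles using (Poset; Setoid)
open import Relation.Binary.Lattice.Bundles using (DistributiveLattice)
import Relation.Binary.Properties.Poset as PosetProperties
import Relation.Binary.Lattice.Properties.MeetSemilattice as MeetSemilatticeProperties
import Relation.Binary.Construct.NonStrictToStrict as ToStrict
import Relation.Binary.Construct.On as On
import Relation.Binary.Reasoning.PartialOrder as PartialOrderReasoning
import Relation.Binary.PropositionalEquality as ≡

module PosetAutomorphisms {a ℓ₁ ℓ₂} (P : Poset a ℓ₁ ℓ₂) where
  open Poset P
  open PosetProperties P using (mono⇒cong)

  Rigid : Set (a ⊔ ℓ₁ ⊔ ℓ₂)
  Rigid = (σ : Automorphism P) → ∀ x → Automorphism.fun σ x ≈ x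

  -- With a single color every automorphism preserves colors, so D(P) = 1
  -- says precisely that P is rigid.
  rigid⇔distNumber1 : Rigid ⇔ DistNumberIs P 1
  rigid⇔distNumber1 = mk⇔ rigid⇒distNumber1 distNumber1⇒rigid
    where
      monochrome : Coloring P 1
      monochrome = record { color = λ _ → zero ; color-cong = λ _ → ≡.refl }

      fin1-unique : (i j : Fin 1) → i ≡.≡ j
      fin1-unique zero zero = ≡.refl

      rigid⇒distNumber1 : Rigid → DistNumberIs P 1
      rigid⇒distNumber1 rigid =
        ℕ.≤-refl , (monochrome , λ σ _ → rigid σ) ,
        λ m 1≤m m<1 _ → ℕ.<⇒≱ m<1 1≤m

      distNumber1⇒rigid : DistNumberIs P 1 → Rigid
      distNumber1⇒rigid (_ , (_ , distinguishing) , _) σ =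
        distinguishing σ (λ _ → fin1-unique _ _)

  orderAutomorphism : (f : Carrier → Carrier) →
    (∀ {x y} → x ≤ y → f x ≤ f y) → (∀ {x y} → f x ≤ f y → x ≤ y) →
    (∀ y → ∃ λ x → f x ≈ y) → Automorphism P
  orderAutomorphism f preserves reflects surjective = record
    { fun        = f
    ; cong       = mono⇒cong preserves
    ; injective  = λ e → antisym (reflects (reflexive e)) (reflects (reflexive (Eq.sym e)))
    ; surjective = surjective
    ; preserves  = preserves
    ; reflects   = reflects
    }

open PosetAutomorphisms using (Rigid; rigid⇔distNumber1; orderAutomorphism)

module FiniteSetoid {c ℓ n} (S : Setoid c ℓ) (enum : Inverse S (≡.setoid (Fin n))) where
  open Setoid S
  open Inverse enum using (to; from; to-cong; inverseʳ; strictlyInverseʳ)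

  ≈-dec : Decidable _≈_
  ≈-dec x y = map′ (λ e → trans (sym (strictlyInverseʳ x)) (inverseʳ e)) to-cong (to x Fin.≟ to y)

  module _ {p} {Pr : Pred Carrier p} (resp : Pr Respects _≈_) (Pr? : Decidable₁ Pr) where
    ∀-dec : Dec (∀ x → Pr x)
    ∀-dec = map′ (λ h x → resp (strictlyInverseʳ x) (h (to x))) (λ h i → h (from i))
                 (Fin.all? (Pr? ∘ from))

    ∃-dec : Dec (∃ Pr)
    ∃-dec = map′ (λ (i , h) → from i , h) (λ (x , h) → to x , resp (sym (strictlyInverseʳ x)) h)
                 (Fin.any? (Pr? ∘ from))

module FinitePoset {c ℓ₁ ℓ₂ n} (P : Poset c ℓ₁ ℓ₂)
    (enum : Inverse (Poset.Eq.setoid P) (≡.setoid (Fin n)))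
    (_≤?_ : Decidable (Poset._≤_ P)) where
  open Poset P
  open PosetProperties P using (_<_; <-respˡ-≈; <-respʳ-≈)
  open Inverse enum using (to; from; strictlyInverseʳ)
  open FiniteSetoid Eq.setoid enum using (≈-dec; ∃-dec)

  -- Pulled back to indices the order is a partial order on Fin n, whose
  -- strict part is well founded; x < y implies the same for the indices.
  <-wellFounded : WellFounded _<_
  <-wellFounded = Subrelation.wellFounded <-on-indices
    (On.wellFounded to (po-wellFounded (On.isPartialOrder from isPartialOrder)))
    where
      <-on-indices : ∀ {x y} → x < y → ToStrict._<_ (_≈_ on from) (_≤_ on from) (to x) (to y)
      <-on-indices x<y =
        <-respʳ-≈ (Eq.sym (strictlyInverseʳ _)) (<-respˡ-≈ (Eq.sym (strictlyInverseʳ _)) x<y)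

  _<?_ : Decidable _<_
  _<?_ = ToStrict.<-decidable _ _ ≈-dec _≤?_

  module _ {p} {Pr : Pred Carrier p} (resp : Pr Respects _≈_) (Pr? : Decidable₁ Pr) where
    Minimal : Carrier → Set (c ⊔ ℓ₁ ⊔ ℓ₂ ⊔ p)
    Minimal z = Pr z × (∀ {w} → Pr w → ¬ w < z)

    minimal-below : ∀ {x} → Pr x → ∃ λ z → z ≤ x × Minimal z
    minimal-below {x} = descend (<-wellFounded x)
      where
        below? : ∀ x → Dec (∃ λ w → Pr w × w < x)
        below? x = ∃-dec (λ e (pw , w<x) → resp e pw , <-respˡ-≈ e w<x)
                         (λ w → Pr? w ×-dec (w <? x))

        descend : ∀ {x} → Acc _<_ x → Pr x → ∃ λ z → z ≤ x × Minimal z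
        descend {x} (acc smaller) px with below? x
        ... | yes (w , pw , w<x) =
          let z , z≤w , minimal = descend (smaller w<x) pw in z , trans z≤w (proj₁ w<x) , minimal
        ... | no nothing-below = x , refl , px , λ pw w<x → nothing-below (_ , pw , w<x)

module JoinIrreducibles {c ℓ₁ ℓ₂} (L : DistributiveLattice c ℓ₁ ℓ₂) where
  open DistributiveLattice L
  open PosetProperties poset using (_<_)

  _⋖_ : Carrier → Carrier → Set (c ⊔ ℓ₁ ⊔ ℓ₂)
  _⋖_ = Defs._⋖_ L

  JI : Carrier → Set (c ⊔ ℓ₁ ⊔ ℓ₂)
  JI = Defs.JoinIrreducible L

  ⋖-resp : ∀ {x x′ y y′} → x ≈ x′ → y ≈ y′ → x ⋖ y → x′ ⋖ y′
  ⋖-resp x≈x′ y≈y′ ((x≤y , x≉y) , between) =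
    (≤-respʳ-≈ y≈y′ (≤-respˡ-≈ x≈x′ x≤y) , λ e → x≉y (Eq.trans x≈x′ (Eq.trans e (Eq.sym y≈y′)))) ,
    λ z x′≤z z≤y′ → Sum.map (λ e → Eq.trans e x≈x′) (λ e → Eq.trans e y≈y′)
                      (between z (≤-respˡ-≈ (Eq.sym x≈x′) x′≤z) (≤-respʳ-≈ (Eq.sym y≈y′) z≤y′))

  JI-resp : JI Respects _≈_
  JI-resp y≈y′ (x , x⋖y , unique) =
    x , ⋖-resp Eq.refl y≈y′ x⋖y , λ z z⋖y′ → unique z (⋖-resp Eq.refl (Eq.sym y≈y′) z⋖y′)

  meet-strict : ∀ {k x} → ¬ k ≤ x → k ∧ x < k
  meet-strict k≰x = x∧y≤x _ _ , λ k∧x≈k → k≰x (≤-respˡ-≈ k∧x≈k (x∧y≤y _ _))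

  -- An automorphism maps covers to covers and back, hence preserves and
  -- reflects join-irreducibility and restricts to an automorphism of Q_L.
  module _ (σ : Automorphism poset) where
    open Automorphism σ renaming (fun to s)

    ⋖-preserved : ∀ {x y} → x ⋖ y → s x ⋖ s y
    ⋖-preserved {x} {y} ((x≤y , x≉y) , between) = (preserves x≤y , x≉y ∘ injective) , between′
      where
        between′ : ∀ z → s x ≤ z → z ≤ s y → z ≈ s x ⊎ z ≈ s y
        between′ z sx≤z z≤sy with surjective z
        ... | w , sw≈z = Sum.map (λ e → Eq.trans (Eq.sym sw≈z) (cong e)) (λ e → Eq.trans (Eq.sym sw≈z) (cong e))
                           (between w (reflects (≤-respʳ-≈ (Eq.sym sw≈z) sx≤z))
                                      (reflects (≤-respˡ-≈ (Eq.sym sw≈z) z≤sy)))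

    ⋖-reflected : ∀ {x y} → s x ⋖ s y → x ⋖ y
    ⋖-reflected ((sx≤sy , sx≉sy) , between) =
      (reflects sx≤sy , sx≉sy ∘ cong) ,
      λ z x≤z z≤y → Sum.map injective injective (between (s z) (preserves x≤z) (preserves z≤y))

    JI-preserved : ∀ {y} → JI y → JI (s y)
    JI-preserved {y} (x , x⋖y , unique) = s x , ⋖-preserved x⋖y , unique′
      where
        unique′ : ∀ z → z ⋖ s y → z ≈ s x
        unique′ z z⋖sy with surjective z
        ... | w , sw≈z = Eq.trans (Eq.sym sw≈z)
                           (cong (unique w (⋖-reflected (⋖-resp (Eq.sym sw≈z) Eq.refl z⋖sy))))

    JI-reflected : ∀ {y} → JI (s y) → JI y
    JI-reflected (x′ , x′⋖sy , unique) with surjective x′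
    ... | w , sw≈x′ = w , ⋖-reflected (⋖-resp (Eq.sym sw≈x′) Eq.refl x′⋖sy) ,
                      λ z z⋖y → injective (Eq.trans (unique (s z) (⋖-preserved z⋖y)) (Eq.sym sw≈x′))

    restrict : Automorphism (Q L)
    restrict = record
      { fun        = λ (y , ji) → s y , JI-preserved ji
      ; cong       = cong
      ; injective  = injective
      ; surjective = λ (y , ji) → let w , sw≈y = surjective y in
                                  (w , JI-reflected (JI-resp (Eq.sym sw≈y) ji)) , sw≈y
      ; preserves  = preserves
      ; reflects   = reflects
      }

module FiniteDistributiveLattice {c ℓ₁ ℓ₂ n} (L : DistributiveLattice c ℓ₁ ℓ₂)
    (enum : Inverse (DistributiveLattice.setoid L) (≡.setoid (Fin n))) where
  open DistributiveLattice L
  open PosetProperties poset using (_<_; <⇒≉; <⇒≱; ≥-poset)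
  open MeetSemilatticeProperties meetSemilattice using (≈-dec⇒≤-dec)
  open Inverse enum using (to; from; strictlyInverseʳ)
  open FiniteSetoid setoid enum using (≈-dec; ∀-dec; ∃-dec)
  open JoinIrreducibles L
  open PartialOrderReasoning poset

  _≤?_ : Decidable _≤_
  _≤?_ = ≈-dec⇒≤-dec ≈-dec

  open FinitePoset poset enum _≤?_ using (_<?_; minimal-below)
  -- Minimal elements for the reverse order are maximal elements.
  module Dual = FinitePoset ≥-poset enum (flip _≤?_)

  -- Every element strictly below k lies below some lower cover of k:
  -- a maximal z with y ≤ z < k is covered by k.
  cover-above : ∀ {y k} → y < k → ∃ λ d → d ⋖ k × y ≤ d
  cover-above {y} {k} y<k with Dual.minimal-below resp (λ z → (y ≤? z) ×-dec (z <? k)) (refl , y<k)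
    where
      resp : (λ z → y ≤ z × z < k) Respects _≈_
      resp e (y≤z , z≤k , z≉k) = ≤-respʳ-≈ e y≤z , ≤-respˡ-≈ e z≤k , λ e′ → z≉k (Eq.trans e e′)
  ... | z , y≤z , (_ , z<k) , nothing-above = z , (z<k , covers) , y≤z
    where
      covers : ∀ w → z ≤ w → w ≤ k → w ≈ z ⊎ w ≈ k
      covers w z≤w w≤k with ≈-dec w k | ≈-dec w z
      ... | yes w≈k | _       = inj₂ w≈k
      ... | no _    | yes w≈z = inj₁ w≈z
      ... | no w≉k  | no w≉z  = ⊥-elim (nothing-above (trans y≤z z≤w , w≤k , w≉k) (z≤w , w≉z))

  -- Join-irreducibles are join-prime.  If k ≰ a and k ≰ b then k ∧ a and
  -- k ∧ b lie below the unique lower cover d of k, and by distributivity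
  -- k ≈ k ∧ (a ∨ b) ≈ (k ∧ a) ∨ (k ∧ b) ≤ d < k.
  JI-prime : ∀ {k a b} → JI k → k ≤ a ∨ b → k ≤ a ⊎ k ≤ b
  JI-prime {k} {a} {b} (d , d⋖k , unique) k≤a∨b with k ≤? a | k ≤? b
  ... | yes k≤a | _       = inj₁ k≤a
  ... | no _    | yes k≤b = inj₂ k≤b
  ... | no k≰a  | no k≰b  = ⊥-elim (<⇒≱ (proj₁ d⋖k) k≤d)
    where
      meet-below-d : ∀ {x} → ¬ k ≤ x → k ∧ x ≤ d
      meet-below-d k≰x = let d′ , d′⋖k , k∧x≤d′ = cover-above (meet-strict k≰x) in
                         ≤-respʳ-≈ (unique d′ d′⋖k) k∧x≤d′

      k≤d : k ≤ d
      k≤d = begin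
        k                 ≤⟨ ∧-greatest refl k≤a∨b ⟩
        k ∧ (a ∨ b)       ≈⟨ ∧-distribˡ-∨ k a b ⟩
        (k ∧ a) ∨ (k ∧ b) ≤⟨ ∨-least (meet-below-d k≰a) (meet-below-d k≰b) ⟩
        d                 ∎

  -- An element z ≰ y all of whose strict lower bounds lie below y is
  -- join-irreducible: z ∧ y < z gives a lower cover d, and any other
  -- lower cover d′ satisfies d ∨ d′ ≈ d (else z ≤ d ∨ d′ ≤ y), so d′ ≈ d.
  JI-if-lowest-outside : ∀ {z y} → ¬ z ≤ y → (∀ {w} → w < z → w ≤ y) → JI z
  JI-if-lowest-outside {z} {y} z≰y below-y with cover-above (meet-strict z≰y)
  ... | d , d⋖z@(d<z , between-d-z) , _ = d , d⋖z , unique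
    where
      unique : ∀ d′ → d′ ⋖ z → d′ ≈ d
      unique d′ (d′<z , between-d′-z) with between-d-z (d ∨ d′) (x≤x∨y d d′) (∨-least (proj₁ d<z) (proj₁ d′<z))
      ... | inj₂ d∨d′≈z = ⊥-elim (z≰y (≤-respˡ-≈ d∨d′≈z (∨-least (below-y d<z) (below-y d′<z))))
      ... | inj₁ d∨d′≈d with between-d′-z d (≤-respʳ-≈ d∨d′≈d (y≤x∨y d d′)) (proj₁ d<z)
      ...   | inj₁ d≈d′ = Eq.sym d≈d′
      ...   | inj₂ d≈z  = ⊥-elim (<⇒≉ d<z d≈z)

  -- Join-density: x ≤ y as soon as every join-irreducible below x is
  -- below y.  Otherwise a minimal z ≤ x with z ≰ y is join-irreducible.
  ≤-by-JI : ∀ {x y} → (∀ j → JI j → j ≤ x → j ≤ y) → x ≤ y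
  ≤-by-JI {x} {y} h = decidable-stable (x ≤? y) λ x≰y →
    let z , _ , (z≤x , z≰y) , minimal =
          minimal-below (λ e (w≤x , w≰y) → ≤-respˡ-≈ e w≤x , w≰y ∘ ≤-respˡ-≈ (Eq.sym e))
                        (λ w → (w ≤? x) ×-dec ¬? (w ≤? y))
                        (refl , x≰y)
        below-y : ∀ {w} → w < z → w ≤ y
        below-y {w} w<z = decidable-stable (w ≤? y) λ w≰y → minimal (trans (proj₁ w<z) z≤x , w≰y) w<z
    in z≰y (h z (JI-if-lowest-outside z≰y below-y) z≤x)

  -- A nonempty finite lattice has a least element: a minimal z is below
  -- every x, since z ∧ x cannot lie strictly below z.
  least : Carrier → ∃ λ b → ∀ x → b ≤ x
  least e = let z , _ , _ , minimal = minimal-below {Pr = λ _ → ⊤} (λ _ _ → tt) (λ _ → yes tt) {x = e} tt in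
            z , λ x → decidable-stable (z ≤? x) λ z≰x → minimal tt (meet-strict z≰x)

  -- Finite joins, with the empty join the least element found from a
  -- given point e; join-irreducibles are prime for them.
  module Joins (e : Carrier) where
    bottom : Carrier
    bottom = proj₁ (least e)

    bottom-≤ : ∀ x → bottom ≤ x
    bottom-≤ = proj₂ (least e)

    JI-not-bottom : ∀ {j} → JI j → ¬ j ≤ bottom
    JI-not-bottom (d , d⋖j , _) j≤bottom = <⇒≱ (proj₁ d⋖j) (trans j≤bottom (bottom-≤ d))

    ⋁ : ∀ {k} → (Fin k → Carrier) → Carrier
    ⋁ {Nat.zero}  f = bottom
    ⋁ {Nat.suc k} f = f zero ∨ ⋁ (f ∘ suc)

    ⋁-ub : ∀ {k} (f : Fin k → Carrier) i → f i ≤ ⋁ f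
    ⋁-ub f zero    = x≤x∨y _ _
    ⋁-ub f (suc i) = trans (⋁-ub (f ∘ suc) i) (y≤x∨y _ _)

    ⋁-least : ∀ {k} (f : Fin k → Carrier) {u} → (∀ i → f i ≤ u) → ⋁ f ≤ u
    ⋁-least {Nat.zero}  f h = bottom-≤ _
    ⋁-least {Nat.suc k} f h = ∨-least (h zero) (⋁-least (f ∘ suc) (h ∘ suc))

    ⋁-prime : ∀ {k j} (f : Fin k → Carrier) → JI j → j ≤ ⋁ f → ∃ λ i → j ≤ f i
    ⋁-prime {Nat.zero}  f ji j≤⋁ = ⊥-elim (JI-not-bottom ji j≤⋁)
    ⋁-prime {Nat.suc k} f ji j≤⋁ with JI-prime ji j≤⋁
    ... | inj₁ j≤f0 = zero , j≤f0
    ... | inj₂ j≤⋁f∘suc = let i , j≤fi = ⋁-prime (f ∘ suc) ji j≤⋁f∘suc in suc i , j≤fi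

  -- Covering and join-irreducibility only quantify over the finite
  -- carrier, so they are decidable; this is needed to select the
  -- join-irreducibles below x in the extension below.
  ⋖-dec : Decidable _⋖_
  ⋖-dec x y = (x <? y) ×-dec ∀-dec between-resp
                (λ z → (x ≤? z) →-dec ((z ≤? y) →-dec (≈-dec z x ⊎-dec ≈-dec z y)))
    where
      between-resp : (λ z → x ≤ z → z ≤ y → z ≈ x ⊎ z ≈ y) Respects _≈_
      between-resp z≈z′ h x≤z′ z′≤y =
        Sum.map (Eq.trans (Eq.sym z≈z′)) (Eq.trans (Eq.sym z≈z′))
                (h (≤-respʳ-≈ (Eq.sym z≈z′) x≤z′) (≤-respˡ-≈ (Eq.sym z≈z′) z′≤y))

  JI-dec : Decidable₁ JI
  JI-dec y = ∃-dec unique-cover-resp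
               (λ x → ⋖-dec x y ×-dec ∀-dec (other-cover-resp x) (λ z → ⋖-dec z y →-dec ≈-dec z x))
    where
      other-cover-resp : ∀ x → (λ z → z ⋖ y → z ≈ x) Respects _≈_
      other-cover-resp x z≈z′ h z′⋖y = Eq.trans (Eq.sym z≈z′) (h (⋖-resp (Eq.sym z≈z′) Eq.refl z′⋖y))

      unique-cover-resp : (λ x → x ⋖ y × (∀ z → z ⋖ y → z ≈ x)) Respects _≈_
      unique-cover-resp x≈x′ (x⋖y , unique) =
        ⋖-resp x≈x′ Eq.refl x⋖y , λ z z⋖y → Eq.trans (unique z z⋖y) x≈x′

  QC : Set (c ⊔ ℓ₁ ⊔ ℓ₂)
  QC = Poset.Carrier (Q L)

  -- The extension of a map t : Q_L → L to all of L,
  -- x ↦ ⋁ { t j | j ∈ Q_L, j ≤ x }, taken as a join over an enumeration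
  -- of L in which the terms outside Q_L ∩ ↓x are the least element.
  -- It is opaque: its uses only need extend-ub, extend-least and
  -- extend-prime, and unfolding the decision procedures is very costly.
  module Extension (t : QC → Carrier) (t-cong : ∀ {p q} → proj₁ p ≈ proj₁ q → t p ≈ t q) where
    opaque
      selected : (x y : Carrier) → Dec (JI y × y ≤ x)
      selected x y = JI-dec y ×-dec (y ≤? x)

      term : (x y : Carrier) → Dec (JI y × y ≤ x) → Carrier
      term x y (yes (ji , _)) = t (y , ji)
      term x y (no _)         = Joins.bottom x

      terms : Carrier → Fin n → Carrier
      terms x i = term x (from i) (selected x (from i))

      extend : Carrier → Carrier
      extend x = Joins.⋁ x (terms x)

      extend-ub : ∀ {x} j (ji : JI j) → j ≤ x → t (j , ji) ≤ extend x
      extend-ub {x} j ji j≤x = trans (t-≤-term (selected x (from (to j))))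
                                     (Joins.⋁-ub x (terms x) (to j))
        where
          t-≤-term : ∀ d → t (j , ji) ≤ term x (from (to j)) d
          t-≤-term (yes _) = reflexive (t-cong (Eq.sym (strictlyInverseʳ j)))
          t-≤-term (no ¬d) = ⊥-elim (¬d (JI-resp (Eq.sym (strictlyInverseʳ j)) ji ,
                                         ≤-respˡ-≈ (Eq.sym (strictlyInverseʳ j)) j≤x))

      extend-least : ∀ {x u} → (∀ j (ji : JI j) → j ≤ x → t (j , ji) ≤ u) → extend x ≤ u
      extend-least {x} {u} h = Joins.⋁-least x (terms x) λ i → term-≤ (from i) (selected x (from i))
        where
          term-≤ : ∀ y d → term x y d ≤ u
          term-≤ y (yes (ji , y≤x)) = h y ji y≤x
          term-≤ y (no _)           = Joins.bottom-≤ x u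

      extend-prime : ∀ {x k} → JI k → k ≤ extend x → ∃ λ q → proj₁ q ≤ x × k ≤ t q
      extend-prime {x} {k} ji k≤extend with Joins.⋁-prime x (terms x) ji k≤extend
      ... | i , k≤term = from-term (from i) (selected x (from i)) k≤term
        where
          from-term : ∀ y d → k ≤ term x y d → ∃ λ q → proj₁ q ≤ x × k ≤ t q
          from-term y (yes (jy , y≤x)) k≤ty = (y , jy) , y≤x , k≤ty
          from-term y (no _)           k≤⊥  = ⊥-elim (Joins.JI-not-bottom x ji k≤⊥)

  -- Rigid Q_L ⇒ rigid L: an automorphism fixing every join-irreducible
  -- is the identity, by join-density.
  fixing-JI⇒identity : (σ : Automorphism poset) →
    (∀ j → JI j → Automorphism.fun σ j ≈ j) → ∀ x → Automorphism.fun σ x ≈ x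
  fixing-JI⇒identity σ fixed x = antisym
    (≤-by-JI λ j ji j≤sx → reflects (≤-respˡ-≈ (Eq.sym (fixed j ji)) j≤sx))
    (≤-by-JI λ j ji j≤x → ≤-respˡ-≈ (fixed j ji) (preserves j≤x))
    where open Automorphism σ

  rigidQ⇒rigidL : Rigid (Q L) → Rigid poset
  rigidQ⇒rigidL rigidQ σ = fixing-JI⇒identity σ λ j ji → rigidQ (restrict σ) (j , ji)

  -- Rigid L ⇒ rigid Q_L: every automorphism τ of Q_L extends to an
  -- automorphism of L, the extension of τ with inverse the extension of τ⁻¹.
  module ExtendAutomorphism (τ : Automorphism (Q L)) where
    open Automorphism τ

    τ⁻¹ : QC → QC
    τ⁻¹ q = proj₁ (surjective q)

    τ∘τ⁻¹ : ∀ q → proj₁ (fun (τ⁻¹ q)) ≈ proj₁ q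
    τ∘τ⁻¹ q = proj₂ (surjective q)

    module Φ = Extension (proj₁ ∘ fun) cong
    module Ψ = Extension (proj₁ ∘ τ⁻¹)
                 (λ {p} {q} e → injective (Eq.trans (τ∘τ⁻¹ p) (Eq.trans e (Eq.sym (τ∘τ⁻¹ q)))))

    φ : Carrier → Carrier
    φ = Φ.extend

    extends : ∀ j (ji : JI j) → φ j ≈ proj₁ (fun (j , ji))
    extends j ji = antisym (Φ.extend-least λ _ _ j′≤j → preserves j′≤j) (Φ.extend-ub j ji refl)

    φ-preserves : ∀ {x y} → x ≤ y → φ x ≤ φ y
    φ-preserves x≤y = Φ.extend-least λ j ji j≤x → Φ.extend-ub j ji (trans j≤x x≤y)

    φ-reflects : ∀ {x y} → φ x ≤ φ y → x ≤ y
    φ-reflects φx≤φy = ≤-by-JI λ j ji j≤x →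
      let q , q≤y , τj≤τq = Φ.extend-prime (proj₂ (fun (j , ji))) (trans (Φ.extend-ub j ji j≤x) φx≤φy)
      in trans (reflects τj≤τq) q≤y

    ψ : Carrier → Carrier
    ψ = Ψ.extend

    φ∘ψ≤ : ∀ y → φ (ψ y) ≤ y
    φ∘ψ≤ y = Φ.extend-least λ j ji j≤ψy →
      let q , q≤y , j≤τ⁻¹q = Ψ.extend-prime ji j≤ψy
      in trans (preserves j≤τ⁻¹q) (≤-respˡ-≈ (Eq.sym (τ∘τ⁻¹ q)) q≤y)

    ≤φ∘ψ : ∀ y → y ≤ φ (ψ y)
    ≤φ∘ψ y = ≤-by-JI λ k kj k≤y →
      let p = τ⁻¹ (k , kj) in
      ≤-respˡ-≈ (τ∘τ⁻¹ (k , kj)) (Φ.extend-ub (proj₁ p) (proj₂ p) (Ψ.extend-ub k kj k≤y))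

    extension : Automorphism poset
    extension = orderAutomorphism poset φ φ-preserves φ-reflects λ y → ψ y , antisym (φ∘ψ≤ y) (≤φ∘ψ y)

  rigidL⇒rigidQ : Rigid poset → Rigid (Q L)
  rigidL⇒rigidQ rigidL τ (j , ji) = Eq.trans (Eq.sym (extends j ji)) (rigidL extension j)
    where open ExtendAutomorphism τ

theorem3p7 : {c ℓ₁ ℓ₂ : Level} (L : DistributiveLattice c ℓ₁ ℓ₂) →
    IsFinite L →
    DistNumberIs (DistributiveLattice.poset L) 1 ⇔ DistNumberIs (Q L) 1
theorem3p7 L (n , enum) =
  ⇔.trans (⇔.sym (rigid⇔distNumber1 (DistributiveLattice.poset L)))
          (⇔.trans (mk⇔ rigidL⇒rigidQ rigidQ⇒rigidL) (rigid⇔distNumber1 (Q L)))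
  where open FiniteDistributiveLattice L enum
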